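{- Let $\Gamma$ be a strictly Deza graph with parameters $(n,k,b,a)$ such that $k=b+1$ and $\beta(\Gamma)>1$. If every vertex of $\Gamma$ is of type (C), then $\Gamma$ is isomorphic to the $2$-clique extension of a complete multipartite graph with parts of size $\frac{n-k+1}{2}$.
   Context: Graphs are finite, simple, undirected. $N(v)$ is the neighbourhood of $v$. A Deza graph with parameters $(n,k,b,a)$, $b\ge a$, is a nonempty $k$-regular graph on $n$ vertices in which every pair of distinct vertices has exactly $b$ or exactly $a$ common neighbours; it is strictly Deza if it has diameter $2$ and is not strongly regular. $B(v)=\{u: |N(u)\cap N(v)|=b\}$; $\beta(\Gamma)=|B(v)|$ (independent of $v$). A vertex $v$ is of type (C) if $|B(v)\cap N(v)|=1$. The extension of $\Delta_1$ by $\Delta_2$ has vertex set $V(\Delta_1)\times V(\Delta_2)$, with $(v_1,v_2)\sim(u_1,u_2)$ iff $v_1u_1$ is an edge of $\Delta_1$, or $v_1=u_1$ and $v_2u_2$ is an edge of $\Delta_2$; the $2$-clique extension of $\Delta_1$ is its extension by $K_2$. -}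

module Defs where

open import Data.Nat using (ℕ; zero; suc; _+_; _*_; _∸_; _≤_; _<_)
open import Data.Fin using (Fin; _≟_)
import Data.Fin as Fin
open import Data.Bool using (Bool; true; false; _∧_; _∨_; not; if_then_else_)
open import Data.Product using (_×_; _,_; Σ; ∃; ∃-syntax)
open import Relation.Nullary using (¬_)
open import Relation.Nullary.Decidable using (⌊_⌋)
open import Relation.Binary.PropositionalEquality using (_≡_; _≢_)
open import Function.Bundles using (_↔_; Inverse)
open import Relation.Binary.Definitions using (DecidableEquality)
open import Data.Product.Properties using (≡-dec)

record Graph (V : Set) : Set where
  field
    adj   : V → V → Bool
    sym   : ∀ u v → adj u v ≡ adj v u
    irrefl : ∀ v → adj v v ≡ false
open Graph public

count : ∀ {n} → (Fin n → Bool) → ℕ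
count {zero}  p = 0
count {suc n} p = (if p Fin.zero then 1 else 0) + count (λ i → p (Fin.suc i))

module _ {n : ℕ} (Γ : Graph (Fin n)) where

  commonNbrs : Fin n → Fin n → ℕ
  commonNbrs u v = count (λ w → adj Γ u w ∧ adj Γ v w)

  degree : Fin n → ℕ
  degree v = count (λ w → adj Γ v w)

  Regular : ℕ → Set
  Regular k = ∀ v → degree v ≡ k

  IsDeza : ℕ → ℕ → ℕ → Set
  IsDeza k b a =
    1 ≤ n × a ≤ b × Regular k ×
    (∀ u v → u ≢ v → (commonNbrs u v ≡ b) Data.Sum.⊎ (commonNbrs u v ≡ a))
    where import Data.Sum

  Diameter2 : Set
  Diameter2 =
    (∀ u v → u ≢ v → adj Γ u v ≡ false → ∃[ w ] (adj Γ u w ≡ true × adj Γ w v ≡ true)) ×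
    (∃[ u ] ∃[ v ] (u ≢ v × adj Γ u v ≡ false))

  IsStronglyRegular : Set
  IsStronglyRegular =
    ∃[ k ] ∃[ λ' ] ∃[ μ ] (Regular k ×
      (∀ u v → u ≢ v → adj Γ u v ≡ true  → commonNbrs u v ≡ λ') ×
      (∀ u v → u ≢ v → adj Γ u v ≡ false → commonNbrs u v ≡ μ))

  IsStrictlyDeza : ℕ → ℕ → ℕ → Set
  IsStrictlyDeza k b a = IsDeza k b a × Diameter2 × ¬ IsStronglyRegular

  inB : ℕ → Fin n → Fin n → Bool
  inB b v u = ⌊ commonNbrs u v Data.Nat.≟ b ⌋
    where import Data.Nat

  sizeB : ℕ → Fin n → ℕ
  sizeB b v = count (inB b v)

  TypeC : ℕ → Fin n → Set
  TypeC b v = count (λ u → inB b v u ∧ adj Γ v u) ≡ 1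

Adj : Set → Set
Adj V = V → V → Bool

extension : ∀ {V₁ V₂ : Set} → DecidableEquality V₁ → Adj V₁ → Adj V₂ → Adj (V₁ × V₂)
extension _≟₁_ Δ₁ Δ₂ (v₁ , v₂) (u₁ , u₂) = Δ₁ v₁ u₁ ∨ (⌊ v₁ ≟₁ u₁ ⌋ ∧ Δ₂ v₂ u₂)

complete : ∀ {m} → Adj (Fin m)
complete i j = not ⌊ i ≟ j ⌋

twoCliqueExtension : ∀ {V : Set} → DecidableEquality V → Adj V → Adj (V × Fin 2)
twoCliqueExtension _≟V_ Δ = extension _≟V_ Δ (complete {2})

completeMultipartite : (t m : ℕ) → Adj (Fin t × Fin m)
completeMultipartite t m (i , _) (i' , _) = not ⌊ i ≟ i' ⌋

≟-pair : ∀ {t m} → DecidableEquality (Fin t × Fin m)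
≟-pair = ≡-dec _≟_ _≟_

Isomorphic : ∀ {n} {W : Set} → Graph (Fin n) → Adj W → Set
Isomorphic {n} {W} Γ Δ =
  Σ (Fin n ↔ W) λ φ → ∀ u v → Δ (Inverse.to φ u) (Inverse.to φ v) ≡ adj Γ u v

-- Type (C) gives every vertex v a unique neighbour τ v with b common neighbours, and since
-- k = b + 1 this forces N(v) ∖ {τ v} = N(τ v) ∖ {v}, so τ is a fixed-point-free involution.
-- The relation "y ∈ {x} ∪ B(x)" holds exactly when N(x) ∖ {τ x} = N(y) ∖ {τ y}, so it is an
-- equivalence relation, and double counting Σ_y |N(x) ∩ N(y)| = k² shows that all its classes
-- have the same size s = 1 + β ≥ 3. Every N(x) ∖ {τ x} is a union of classes, hence for x, y
-- in different classes a = |N(x) ∩ N(y)| is ≡ 0 (mod s) if x ≁ y and ≡ 2 (mod s) if x ~ y.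
-- Since x has neighbours outside its class, the first case never occurs: distinct classes are
-- completely joined, and inside a class the only edges are the pairs {v, τ v}. Picking one
-- point of each pair, the classes form a complete multipartite graph with parts of size s / 2,
-- and Γ is its 2-clique extension.

module Submission where

open import Defs hiding (sym)

open import Algebra.Bundles using (CommutativeMonoid)
open import Data.Bool using (Bool; true; false; _∧_; _∨_; not; if_then_else_; T)
open import Data.Bool.Properties
  using (T-∧; T-∨; T-irrelevant; ∧-comm; ∧-assoc; ∧-idem; ∧-identityʳ; ∧-commutativeMonoid)
open import Algebra.Properties.CommutativeSemigroup (CommutativeMonoid.commutativeSemigroup ∧-commutativeMonoid)
  using (interchange)
open import Data.Empty using (⊥-elim)
open import Data.Fin using (Fin; zero; suc; _≟_; _<?_; opposite)
import Data.Fin as Fin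
import Data.Fin.Properties as Fin
open import Data.Fin.Properties using (0↔⊥; 1↔⊤; +↔⊎; *↔×; <-asym; <-cmp)
open import Data.Fin.Permutation using (Permutation; permutation; _⟨$⟩ʳ_; ↔⇒≡; cast-id)
open import Data.Maybe as Maybe using (Maybe; just; nothing; fromMaybe)
open import Data.Nat using (ℕ; zero; suc; _+_; _*_; _∸_; _<_; _≤_; z≤n; s≤s; s≤s⁻¹)
open import Data.Nat.Divisibility using (_∣_; divides; ∣m+n∣m⇒∣n; ∣⇒≤)
import Data.Nat.Properties as ℕ
open import Data.Nat.Tactic.RingSolver using (solve-∀)
open import Algebra.Properties.CommutativeMonoid.Sum ℕ.+-0-commutativeMonoid
  using (sum-syntax; sum-cong-≗; ∑-comm; ∑-distrib-+; ∑-permute; sum-replicate-zero)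
open import Data.Product using (Σ; _×_; _,_; proj₁; proj₂; ∃; ∃-syntax)
import Data.Product.Function.Dependent.Propositional as Σ
open import Data.Product.Function.NonDependent.Propositional using (_×-↔_)
open import Data.Sum using (_⊎_; inj₁; inj₂; [_,_]′)
open import Data.Sum.Function.Propositional using (_⊎-↔_)
open import Data.Unit using (tt)
open import Function using (id; _∘_; _↔_; _⇔_; Equivalence; Inverse; Injection; mk↔ₛ′; mk⇔)
open import Function.Properties.Inverse using (↔-refl; ↔-sym; ↔-trans; ↔⇒↣)
open import Function.Related.Propositional using (bijection)
open import Relation.Binary.Definitions using (tri<; tri≈; tri>)
open import Relation.Binary.PropositionalEquality
  using (_≡_; _≢_; refl; sym; trans; cong; cong₂; subst; subst₂; module ≡-Reasoning)
open import Relation.Binary.Structures using (IsEquivalence)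
open import Relation.Nullary using (¬_; contradiction; yes; no)
open import Relation.Nullary.Decidable
  using (⌊_⌋; toWitness; fromWitness; toWitnessFalse; fromWitnessFalse; T?; does-⇔)

private
  variable
    n : ℕ
    p q : Fin n → Bool

T-∧-intro : ∀ {x y} → T x → T y → T (x ∧ y)
T-∧-intro tx ty = Equivalence.from T-∧ (tx , ty)

T-∧-elim : ∀ x {y} → T (x ∧ y) → T x × T y
T-∧-elim x = Equivalence.to (T-∧ {x})

T-not : ∀ {x} → ¬ T x → T (not x)
T-not {false} _  = tt
T-not {true}  ¬x = ¬x tt

T-not⁻¹ : ∀ {x} → T (not x) → ¬ T x
T-not⁻¹ {false} _ ()

T-injective : ∀ {x y} → (T x → T y) → (T y → T x) → x ≡ y
T-injective f g = does-⇔ (mk⇔ f g) (T? _) (T? _)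

↔-injective : ∀ {A B : Set} (e : A ↔ B) {x y} → Inverse.to e x ≡ Inverse.to e y → x ≡ y
↔-injective e = Injection.injective (↔⇒↣ e)

-- Counting the elements of a Boolean predicate on Fin n

count-cong : (∀ i → p i ≡ q i) → count p ≡ count q
count-cong {zero}  _   = refl
count-cong {suc n} p≗q = cong₂ _+_ (cong (λ b → if b then 1 else 0) (p≗q zero)) (count-cong (p≗q ∘ suc))

count-split : (p q : Fin n → Bool) →
              count p ≡ count (λ i → p i ∧ q i) + count (λ i → p i ∧ not (q i))
count-split {zero}  p q = refl
count-split {suc n} p q with p zero | q zero | count-split (p ∘ suc) (q ∘ suc)
... | true  | true  | ih = cong suc ih
... | true  | false | ih = trans (cong suc ih) (sym (ℕ.+-suc _ _))
... | false | _     | ih = ih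

count-true : count {n} (λ _ → true) ≡ n
count-true {zero}  = refl
count-true {suc n} = cong suc (count-true {n})

count≡0⇒¬T : count p ≡ 0 → ∀ i → ¬ T (p i)
count≡0⇒¬T {suc n} {p} eq i with p zero in p0
count≡0⇒¬T {suc n} {p} () i       | true
count≡0⇒¬T {suc n} {p} eq zero    | false = subst T p0
count≡0⇒¬T {suc n} {p} eq (suc i) | false = count≡0⇒¬T eq i

count-pos : (p : Fin n → Bool) → 0 < count p → ∃ λ i → T (p i)
count-pos {suc n} p pos with p zero in p0
... | true  = zero , subst T (sym p0) tt
... | false = let i , t = count-pos (p ∘ suc) pos in suc i , t

count-mono : (∀ i → T (p i) → T (q i)) → count p ≤ count q
count-mono {zero}          p⊆q = z≤n
count-mono {suc n} {p} {q} p⊆q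
  with p zero | q zero | p⊆q zero | count-mono {p = p ∘ suc} {q ∘ suc} (p⊆q ∘ suc)
... | true  | true  | _    | ih = s≤s ih
... | true  | false | p⊆q₀ | ih = ⊥-elim (p⊆q₀ tt)
... | false | true  | _    | ih = ℕ.m≤n⇒m≤1+n ih
... | false | false | _    | ih = ih

count≡1⇒unique : count p ≡ 1 → ∀ {i j} → T (p i) → T (p j) → i ≡ j
count≡1⇒unique {suc n} {p} eq {i} {j} pi pj with p zero in p0
count≡1⇒unique {suc n} {p} eq {zero}  {zero}  pi pj | _     = refl
count≡1⇒unique {suc n} {p} eq {zero}  {suc j} pi pj | true  = ⊥-elim (count≡0⇒¬T (ℕ.suc-injective eq) j pj)
count≡1⇒unique {suc n} {p} eq {suc i} {_}     pi pj | true  = ⊥-elim (count≡0⇒¬T (ℕ.suc-injective eq) i pi)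
count≡1⇒unique {suc n} {p} eq {zero}  {_}     pi pj | false = ⊥-elim (subst T p0 pi)
count≡1⇒unique {suc n} {p} eq {suc i} {zero}  pi pj | false = ⊥-elim (subst T p0 pj)
count≡1⇒unique {suc n} {p} eq {suc i} {suc j} pi pj | false = cong suc (count≡1⇒unique eq pi pj)

¬T⇒count≡0 : (∀ i → ¬ T (p i)) → count p ≡ 0
¬T⇒count≡0 {zero}      none = refl
¬T⇒count≡0 {suc n} {p} none with p zero in p0
... | true  = ⊥-elim (none zero (subst T (sym p0) tt))
... | false = ¬T⇒count≡0 (none ∘ suc)

count-singleton : ∀ {z} → T (p z) → (∀ i → T (p i) → i ≡ z) → count p ≡ 1
count-singleton {suc n} {p} {zero} pz only with p zero
... | true  = cong suc (¬T⇒count≡0 λ i pi → contradiction (only (suc i) pi) λ ())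
... | false = ⊥-elim pz
count-singleton {suc n} {p} {suc z} pz only with p zero in p0
... | true  = contradiction (only zero (subst T (sym p0) tt)) λ ()
... | false = count-singleton pz (λ i pi → Fin.suc-injective (only (suc i) pi))

count-remove : (p : Fin n → Bool) → ∀ {z} → T (p z) →
               count p ≡ suc (count (λ i → p i ∧ not ⌊ i ≟ z ⌋))
count-remove p {z} pz = trans (count-split p (λ i → ⌊ i ≟ z ⌋)) (cong₂ _+_ single refl)
  where
  single : count (λ i → p i ∧ ⌊ i ≟ z ⌋) ≡ 1
  single = count-singleton {p = λ i → p i ∧ ⌊ i ≟ z ⌋} (T-∧-intro pz (fromWitness refl))
                           (λ i t → toWitness (proj₂ (T-∧-elim (p i) t)))

count-≟ : ∀ (z : Fin n) → count (λ i → ⌊ z ≟ i ⌋) ≡ 1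
count-≟ z = count-singleton {p = λ i → ⌊ z ≟ i ⌋} (fromWitness refl) (λ i t → sym (toWitness t))

count-∨ : (∀ i → T (p i) → ¬ T (q i)) → count (λ i → p i ∨ q i) ≡ count p + count q
count-∨ {zero}          disjoint = refl
count-∨ {suc n} {p} {q} disjoint
  with p zero | q zero | disjoint zero | count-∨ {p = p ∘ suc} {q ∘ suc} (disjoint ∘ suc)
... | true  | true  | d | _  = ⊥-elim (d _ _)
... | true  | false | _ | ih = cong suc ih
... | false | true  | _ | ih = trans (cong suc ih) (sym (ℕ.+-suc _ _))
... | false | false | _ | ih = ih

count-≤⇒⊇ : (∀ i → T (p i) → T (q i)) → count q ≤ count p → ∀ i → T (q i) → T (p i)
count-≤⇒⊇ {suc n} {p} {q} p⊆q q≤p i qi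
  with p zero in p0 | q zero in q0 | p⊆q zero | count-mono {p = p ∘ suc} {q ∘ suc} (p⊆q ∘ suc)
... | false | true  | _  | tail≤ = ⊥-elim (ℕ.<-irrefl refl (ℕ.≤-trans q≤p tail≤))
... | true  | false | p⊆q₀ | _   = ⊥-elim (p⊆q₀ tt)
count-≤⇒⊇ {suc n} p⊆q q≤p zero    qi | true  | true  | _ | _ = subst T (sym p0) tt
count-≤⇒⊇ {suc n} p⊆q q≤p (suc i) qi | true  | true  | _ | _ = count-≤⇒⊇ (p⊆q ∘ suc) (s≤s⁻¹ q≤p) i qi
count-≤⇒⊇ {suc n} p⊆q q≤p zero    qi | false | false | _ | _ = ⊥-elim (subst T q0 qi)
count-≤⇒⊇ {suc n} p⊆q q≤p (suc i) qi | false | false | _ | _ = count-≤⇒⊇ (p⊆q ∘ suc) q≤p i qi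

Members : (Fin n → Bool) → Set
Members p = Σ (Fin _) (T ∘ p)

Members-≡ : {x y : Members p} → proj₁ x ≡ proj₁ y → x ≡ y
Members-≡ {x = i , s} {.i , t} refl = cong (i ,_) (T-irrelevant s t)

T↔Fin : (b : Bool) → T b ↔ Fin (if b then 1 else 0)
T↔Fin true  = ↔-sym 1↔⊤
T↔Fin false = ↔-sym 0↔⊥

Members-suc : (p : Fin (suc n) → Bool) → Members p ↔ (T (p zero) ⊎ Members (p ∘ suc))
Members-suc p = mk↔ₛ′
  (λ { (zero , t) → inj₁ t ; (suc i , t) → inj₂ (i , t) })
  [ zero ,_ , (λ (i , t) → suc i , t) ]′
  (λ { (inj₁ _) → refl ; (inj₂ _) → refl })
  (λ { (zero , _) → refl ; (suc _ , _) → refl })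

Members↔Fin-count : (p : Fin n → Bool) → Members p ↔ Fin (count p)
Members↔Fin-count {zero}  p = mk↔ₛ′ (λ ()) (λ ()) (λ ()) (λ ())
Members↔Fin-count {suc n} p = ↔-trans (Members-suc p)
  (↔-trans (T↔Fin (p zero) ⊎-↔ Members↔Fin-count (p ∘ suc)) (↔-sym +↔⊎))

count-as-sum : (p : Fin n → Bool) → count p ≡ ∑[ i < n ] (if p i then 1 else 0)
count-as-sum {zero}  p = refl
count-as-sum {suc n} p = cong ((if p zero then 1 else 0) +_) (count-as-sum (p ∘ suc))

count-permute : (π : Permutation n n) (p : Fin n → Bool) → count (p ∘ (π ⟨$⟩ʳ_)) ≡ count p
count-permute π p = begin
  count (p ∘ (π ⟨$⟩ʳ_))                   ≡⟨ count-as-sum (p ∘ (π ⟨$⟩ʳ_)) ⟩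
  ∑[ i < _ ] (if p (π ⟨$⟩ʳ i) then 1 else 0) ≡⟨ ∑-permute (λ i → if p i then 1 else 0) π ⟨
  ∑[ i < _ ] (if p i then 1 else 0)         ≡⟨ count-as-sum p ⟨
  count p                                  ∎
  where open ≡-Reasoning

∑-if : (p : Fin n → Bool) (c d : ℕ) →
       ∑[ i < n ] (if p i then c else d) ≡ c * count p + d * count (not ∘ p)
∑-if {zero}  p c d = sym (cong₂ _+_ (ℕ.*-zeroʳ c) (ℕ.*-zeroʳ d))
∑-if {suc n} p c d with p zero | ∑-if (p ∘ suc) c d
... | true  | ih = trans (cong (c +_) ih) (shift c d _ _)
  where shift : ∀ c d x y → c + (c * x + d * y) ≡ c * suc x + d * y
        shift = solve-∀
... | false | ih = trans (cong (d +_) ih) (shift c d _ _)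
  where shift : ∀ c d x y → d + (c * x + d * y) ≡ c * x + d * suc y
        shift = solve-∀

split-by-weights : ∀ {a b u v u′ v′} → a < b →
                   b * u + a * v ≡ b * u′ + a * v′ → u + v ≡ u′ + v′ → u ≡ u′
split-by-weights {a} {b} {u} {v} {u′} {v′} a<b weighted total with ℕ.m≤n⇒∃[o]m+o≡n a<b
... | d , refl = ℕ.*-cancelˡ-≡ u u′ (suc d) (ℕ.+-cancelˡ-≡ (a * (u + v)) _ _ (begin
  a * (u + v) + suc d * u          ≡⟨ regroup a d u v ⟨
  (suc a + d) * u + a * v          ≡⟨ weighted ⟩
  (suc a + d) * u′ + a * v′        ≡⟨ regroup a d u′ v′ ⟩
  a * (u′ + v′) + suc d * u′       ≡⟨ cong (λ t → a * t + suc d * u′) total ⟨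
  a * (u + v) + suc d * u′         ∎))
  where
  open ≡-Reasoning
  regroup : ∀ a d u v → (suc a + d) * u + a * v ≡ a * (u + v) + suc d * u
  regroup = solve-∀

-- Partitions into classes of equal size

first : (Fin n → Bool) → Maybe (Fin n)
first {zero}  p = nothing
first {suc n} p = if p zero then just zero else Maybe.map suc (first (p ∘ suc))

first-cong : (∀ i → p i ≡ q i) → first p ≡ first q
first-cong {zero}          p≗q = refl
first-cong {suc n} {p} {q} p≗q rewrite p≗q zero | first-cong {p = p ∘ suc} {q ∘ suc} (p≗q ∘ suc) = refl

first-sound : (p : Fin n → Bool) → ∀ {i} → first p ≡ just i → T (p i)
first-sound {suc n} p eq with p zero in p0 | first (p ∘ suc) in eq′
first-sound {suc n} p refl | true  | _      = subst T (sym p0) tt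
first-sound {suc n} p refl | false | just j = first-sound (p ∘ suc) eq′

first-complete : (p : Fin n → Bool) → ∀ i → T (p i) → ∃ λ j → first p ≡ just j
first-complete {suc n} p i pi with p zero in p0
... | true = zero , refl
first-complete {suc n} p zero    pi | false = ⊥-elim (subst T p0 pi)
first-complete {suc n} p (suc i) pi | false with first-complete (p ∘ suc) i pi
... | j , eq rewrite eq = suc j , refl

record Partition (D : Fin n → Bool) (E : Fin n → Fin n → Bool) (c : ℕ) : Set where
  field
    parts      : ℕ
    index      : Members D ↔ (Fin parts × Fin c)
    same-part⇔ : ∀ x y → proj₁ (Inverse.to index x) ≡ proj₁ (Inverse.to index y) ⇔ T (E (proj₁ x) (proj₁ y))

module _ (D : Fin n → Bool) (E : Fin n → Fin n → Bool)
         (E-equiv : IsEquivalence (λ x y → T (E x y))) (c : ℕ)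
         (class-size : ∀ x → T (D x) → count (λ y → D y ∧ E x y) ≡ c) where

  open IsEquivalence E-equiv renaming (refl to E-refl; sym to E-sym; trans to E-trans)

  private
    class : Fin n → Fin n → Bool
    class x y = D y ∧ E x y

    rep : Fin n → Fin n
    rep x = fromMaybe x (first (class x))

    first-class : ∀ x → T (D x) → first (class x) ≡ just (rep x)
    first-class x dx with first-complete (class x) x (T-∧-intro dx E-refl)
    ... | j , eq rewrite eq = refl

    rep-class : ∀ x → T (D x) → T (class x (rep x))
    rep-class x dx = first-sound (class x) (first-class x dx)

    rep-E : ∀ x → T (D x) → T (E (rep x) x)
    rep-E x dx = E-sym (proj₂ (T-∧-elim (D (rep x)) (rep-class x dx)))

    rep-D : ∀ x → T (D x) → T (D (rep x))
    rep-D x dx = proj₁ (T-∧-elim (D (rep x)) (rep-class x dx))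

    class-cong : ∀ {x y} → T (E x y) → ∀ z → class y z ≡ class x z
    class-cong xy z = cong (D z ∧_) (T-injective (E-trans xy) (E-trans (E-sym xy)))

    rep-cong : ∀ {x y} → T (D x) → T (E x y) → rep y ≡ rep x
    rep-cong {x} {y} dx xy = begin
      fromMaybe y (first (class y)) ≡⟨ cong (fromMaybe y) (first-cong (class-cong xy)) ⟩
      fromMaybe y (first (class x)) ≡⟨ cong (fromMaybe y) (first-class x dx) ⟩
      rep x                         ∎
      where open ≡-Reasoning

    IsRep : Fin n → Bool
    IsRep r = D r ∧ ⌊ rep r ≟ r ⌋

    rep-IsRep : ∀ x → T (D x) → T (IsRep (rep x))
    rep-IsRep x dx = T-∧-intro (rep-D x dx) (fromWitness (sym (rep-cong (rep-D x dx) (rep-E x dx))))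

    Fibres : Set
    Fibres = Σ (Members IsRep) (λ r → Members (class (proj₁ r)))

    fibres-≡ : ∀ {r r′ y} {pr : T (IsRep r)} {pr′ : T (IsRep r′)} {py : T (class r y)} {py′ : T (class r′ y)} →
               r ≡ r′ → _≡_ {A = Fibres} ((r , pr) , (y , py)) ((r′ , pr′) , (y , py′))
    fibres-≡ {pr = pr} {pr′} {py} {py′} refl rewrite T-irrelevant pr pr′ | T-irrelevant py py′ = refl

    Members↔Fibres : Members D ↔ Fibres
    Members↔Fibres = mk↔ₛ′
      (λ (x , dx) → (rep x , rep-IsRep x dx) , (x , T-∧-intro dx (rep-E x dx)))
      (λ (_ , (y , py)) → y , proj₁ (T-∧-elim (D y) py))
      (λ ((r , pr) , (y , py)) → let dr , r-rep = T-∧-elim (D r) pr in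
         fibres-≡ (trans (rep-cong dr (proj₂ (T-∧-elim (D y) py))) (toWitness r-rep)))
      (λ _ → Members-≡ refl)

  opaque
    partition : Partition D E c
    partition = record
      { parts      = count IsRep
      ; index      = ↔-trans Members↔Fibres
                       (↔-trans (Σ.congˡ {k = bijection} λ {(r , pr)} →
                                   ↔-trans (Members↔Fin-count (class r))
                                           (cast-id (class-size r (proj₁ (T-∧-elim (D r) pr)))))
                                (Members↔Fin-count IsRep ×-↔ ↔-refl))
      ; same-part⇔ = λ (x , dx) (y , dy) → mk⇔
          (λ eq → let rx≡ry = cong proj₁ (↔-injective (Members↔Fin-count IsRep) eq) in
                   E-trans (E-sym (rep-E x dx)) (subst (λ r → T (E r y)) (sym rx≡ry) (rep-E y dy)))
          (λ xy → cong (Inverse.to (Members↔Fin-count IsRep)) (Members-≡ (sym (rep-cong dx xy))))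
      }

Partition-∣ : ∀ {D : Fin n → Bool} {E c} → Partition D E c → c ∣ count D
Partition-∣ {D = D} P = divides parts
  (↔⇒≡ (↔-trans (↔-sym (Members↔Fin-count D)) (↔-trans index (↔-sym *↔×))))
  where open Partition P

-- Orbits of a fixed-point-free involution

≢-opposite : (i : Fin 2) → i ≢ opposite i
≢-opposite zero       ()
≢-opposite (suc zero) ()

module Orbits (σ : Fin n → Fin n) (σ-involutive : ∀ x → σ (σ x) ≡ x) (σ-fixfree : ∀ x → σ x ≢ x) where

  lower : Fin n → Bool
  lower x = ⌊ x <? σ x ⌋

  ¬lower⇒lower-σ : ∀ x → ¬ T (lower x) → T (lower (σ x))
  ¬lower⇒lower-σ x x≮σx with <-cmp x (σ x)
  ... | tri< x<σx _    _    = ⊥-elim (x≮σx (fromWitness x<σx))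
  ... | tri≈ _    x≡σx _    = ⊥-elim (σ-fixfree x (sym x≡σx))
  ... | tri> _    _    σx<x = fromWitness (subst (Fin._<_ (σ x)) (sym (σ-involutive x)) σx<x)

  lower⇒¬lower-σ : ∀ x → T (lower x) → ¬ T (lower (σ x))
  lower⇒¬lower-σ x lx lσx = <-asym (toWitness lx) (subst (Fin._<_ (σ x)) (σ-involutive x) (toWitness lσx))

  orbit : Fin n → Members lower × Fin 2
  orbit x with T? (lower x)
  ... | yes lx  = (x , lx) , zero
  ... | no  ¬lx = (σ x , ¬lower⇒lower-σ x ¬lx) , suc zero

  point : Members lower × Fin 2 → Fin n
  point ((r , _) , zero)     = r
  point ((r , _) , suc zero) = σ r

  point-orbit : ∀ x → point (orbit x) ≡ x
  point-orbit x with T? (lower x)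
  ... | yes _ = refl
  ... | no  _ = σ-involutive x

  orbit-point : ∀ y → orbit (point y) ≡ y
  orbit-point ((r , lr) , zero) with T? (lower r)
  ... | yes _   = cong (_, zero) (Members-≡ refl)
  ... | no  ¬lr = ⊥-elim (¬lr lr)
  orbit-point ((r , lr) , suc zero) with T? (lower (σ r))
  ... | yes lσr = ⊥-elim (lower⇒¬lower-σ r lr lσr)
  ... | no  _   = cong (_, suc zero) (Members-≡ (σ-involutive r))

  orbits : Fin n ↔ (Members lower × Fin 2)
  orbits = mk↔ₛ′ orbit point orbit-point point-orbit

  point-opposite : ∀ r {i j} → i ≢ j → point (r , j) ≡ σ (point (r , i))
  point-opposite r {zero}     {zero}     i≢j = ⊥-elim (i≢j refl)
  point-opposite r {zero}     {suc zero} _   = refl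
  point-opposite r {suc zero} {zero}     _   = sym (σ-involutive _)
  point-opposite r {suc zero} {suc zero} i≢j = ⊥-elim (i≢j refl)

  orbit-σ : ∀ x → orbit (σ x) ≡ (proj₁ (orbit x) , opposite (proj₂ (orbit x)))
  orbit-σ x = begin
    orbit (σ x)                          ≡⟨ cong (orbit ∘ σ) (point-orbit x) ⟨
    orbit (σ (point (r , i)))            ≡⟨ cong orbit (point-opposite r (≢-opposite i)) ⟨
    orbit (point (r , opposite i))       ≡⟨ orbit-point (r , opposite i) ⟩
    (r , opposite i)                     ∎
    where
    open ≡-Reasoning
    r = proj₁ (orbit x)
    i = proj₂ (orbit x)

  orbit-rep : ∀ x → proj₁ (proj₁ (orbit x)) ≡ x ⊎ proj₁ (proj₁ (orbit x)) ≡ σ x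
  orbit-rep x with T? (lower x)
  ... | yes _ = inj₁ refl
  ... | no  _ = inj₂ refl

  twins⇔ : ∀ x y → (proj₁ (orbit x) ≡ proj₁ (orbit y) × proj₂ (orbit x) ≢ proj₂ (orbit y)) ⇔ y ≡ σ x
  twins⇔ x y = mk⇔ twins⇒ λ { refl →
    cong proj₁ (sym (orbit-σ x)) , λ eq → ≢-opposite _ (trans eq (cong proj₂ (orbit-σ x))) }
    where
    twins⇒ : proj₁ (orbit x) ≡ proj₁ (orbit y) × proj₂ (orbit x) ≢ proj₂ (orbit y) → y ≡ σ x
    twins⇒ (same , differ) = begin
      y                                         ≡⟨ point-orbit y ⟨
      point (proj₁ (orbit y) , proj₂ (orbit y)) ≡⟨ cong (λ r → point (r , proj₂ (orbit y))) same ⟨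
      point (proj₁ (orbit x) , proj₂ (orbit y)) ≡⟨ point-opposite (proj₁ (orbit x)) differ ⟩
      σ (point (orbit x))                       ≡⟨ cong σ (point-orbit x) ⟩
      σ x                                       ∎
      where open ≡-Reasoning

-- Deza graphs

∑-commonNbrs : ∀ {k} (Γ : Graph (Fin n)) → Regular Γ k → ∀ x → ∑[ y < n ] commonNbrs Γ x y ≡ k * k
∑-commonNbrs {n} {k} Γ regular x = begin
  ∑[ y < n ] count (λ w → A x w ∧ A y w)                ≡⟨ sum-cong-≗ (λ y → count-as-sum (λ w → A x w ∧ A y w)) ⟩
  ∑[ y < n ] ∑[ w < n ] (if A x w ∧ A y w then 1 else 0) ≡⟨ ∑-comm (λ y w → if A x w ∧ A y w then 1 else 0) ⟩
  ∑[ w < n ] ∑[ y < n ] (if A x w ∧ A y w then 1 else 0) ≡⟨ sum-cong-≗ inner ⟩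
  ∑[ w < n ] (if A x w then k else 0)                    ≡⟨ ∑-if (A x) k 0 ⟩
  k * count (A x) + 0                                    ≡⟨ ℕ.+-identityʳ _ ⟩
  k * count (A x)                                        ≡⟨ cong (k *_) (regular x) ⟩
  k * k                                                  ∎
  where
  open ≡-Reasoning
  A = adj Γ
  inner : ∀ w → ∑[ y < n ] (if A x w ∧ A y w then 1 else 0) ≡ (if A x w then k else 0)
  inner w with A x w
  ... | true  = trans (sym (count-as-sum (λ y → A y w))) (trans (count-cong (λ y → Graph.sym Γ y w)) (regular w))
  ... | false = sum-replicate-zero n

Deza⇒a<b : ∀ (Γ : Graph (Fin n)) {k b a} → IsDeza Γ k b a → ¬ IsStronglyRegular Γ → a < b
Deza⇒a<b Γ {k} {b} (_ , a≤b , regular , dichotomy) ¬srg = ℕ.≤∧≢⇒< a≤b λ a≡b →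
  let always-b = λ u v u≢v → [ id , (λ cn≡a → trans cn≡a a≡b) ]′ (dichotomy u v u≢v)
  in ¬srg (k , b , b , regular , (λ u v u≢v _ → always-b u v u≢v) , (λ u v u≢v _ → always-b u v u≢v))

module TypeCDeza {n k b a : ℕ} (Γ : Graph (Fin n)) (deza : IsDeza Γ k b a) (a<b : a < b)
                 (k≡b+1 : k ≡ b + 1) (β>1 : ∀ v → 1 < sizeB Γ b v) (typeC : ∀ v → TypeC Γ b v) where

  private
    variable
      u v w x y : Fin n

  regular : Regular Γ k
  regular = proj₁ (proj₂ (proj₂ deza))

  dichotomy : ∀ u v → u ≢ v → commonNbrs Γ u v ≡ b ⊎ commonNbrs Γ u v ≡ a
  dichotomy = proj₂ (proj₂ (proj₂ deza))

  A : Fin n → Fin n → Bool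
  A = adj Γ

  _~_ : Fin n → Fin n → Set
  x ~ y = T (A x y)

  cn : Fin n → Fin n → ℕ
  cn = commonNbrs Γ

  ~-sym : x ~ y → y ~ x
  ~-sym {x} {y} = subst T (Graph.sym Γ x y)

  ~-irrefl : ¬ x ~ x
  ~-irrefl {x} = subst T (Graph.irrefl Γ x)

  ~⇒≢ : x ~ y → x ≢ y
  ~⇒≢ x~x refl = ~-irrefl x~x

  cn-sym : ∀ x y → cn x y ≡ cn y x
  cn-sym x y = count-cong (λ w → ∧-comm (A x w) (A y w))

  cn-diag : ∀ x → cn x x ≡ suc b
  cn-diag x = trans (count-cong (λ w → ∧-idem (A x w))) (trans (regular x) (trans k≡b+1 (ℕ.+-comm b 1)))

  cn≡b⇒≢ : cn x y ≡ b → x ≢ y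
  cn≡b⇒≢ {x} cn≡b refl = ℕ.1+n≢n (trans (sym (cn-diag x)) cn≡b)

  -- Since k = b + 1, y is the only neighbour of x outside N(y).
  ~-cn≡b⇒N⊆ : x ~ y → cn x y ≡ b → w ≢ y → x ~ w → y ~ w
  ~-cn≡b⇒N⊆ {x} {y} {w} x~y cn≡b w≢y x~w with T? (A y w)
  ... | yes y~w = y~w
  ... | no  y≁w =
    ⊥-elim (w≢y (count≡1⇒unique only-y (T-∧-intro x~w (T-not y≁w)) (T-∧-intro x~y (T-not ~-irrefl))))
    where
    outside : ℕ
    outside = count (λ w → A x w ∧ not (A y w))
    only-y : outside ≡ 1
    only-y = ℕ.+-cancelˡ-≡ b _ _ (begin
      b + outside      ≡⟨ cong (_+ outside) cn≡b ⟨
      cn x y + outside ≡⟨ count-split (A x) (A y) ⟨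
      count (A x)      ≡⟨ trans (regular x) k≡b+1 ⟩
      b + 1            ∎)
      where open ≡-Reasoning

  B∩N : Fin n → Fin n → Bool
  B∩N v u = inB Γ b v u ∧ A v u

  τ : Fin n → Fin n
  τ v = proj₁ (count-pos (B∩N v) (subst (0 <_) (sym (typeC v)) (s≤s z≤n)))

  τ-spec : ∀ v → T (B∩N v (τ v))
  τ-spec v = proj₂ (count-pos (B∩N v) (subst (0 <_) (sym (typeC v)) (s≤s z≤n)))

  τ-~ : ∀ v → v ~ τ v
  τ-~ v = proj₂ (T-∧-elim (inB Γ b v (τ v)) (τ-spec v))

  τ-cn : ∀ v → cn v (τ v) ≡ b
  τ-cn v = trans (cn-sym v (τ v)) (toWitness (proj₁ (T-∧-elim (inB Γ b v (τ v)) (τ-spec v))))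

  τ-unique : v ~ u → cn v u ≡ b → u ≡ τ v
  τ-unique {v} {u} v~u cn≡b =
    count≡1⇒unique (typeC v) (T-∧-intro (fromWitness (trans (cn-sym u v) cn≡b)) v~u) (τ-spec v)

  τ-involutive : ∀ x → τ (τ x) ≡ x
  τ-involutive x = sym (τ-unique (~-sym (τ-~ x)) (trans (cn-sym (τ x) x) (τ-cn x)))

  τ-fixfree : ∀ x → τ x ≢ x
  τ-fixfree x τx≡x = ~⇒≢ (τ-~ x) (sym τx≡x)

  N∖τ : Fin n → Fin n → Bool
  N∖τ x w = A x w ∧ not ⌊ w ≟ τ x ⌋

  N∖τ-intro : x ~ w → w ≢ τ x → T (N∖τ x w)
  N∖τ-intro x~w w≢τx = T-∧-intro x~w (fromWitnessFalse w≢τx)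

  N∖τ⇒~ : T (N∖τ x w) → x ~ w
  N∖τ⇒~ {x} {w} t = proj₁ (T-∧-elim (A x w) t)

  N∖τ⇒≢ : T (N∖τ x w) → w ≢ τ x
  N∖τ⇒≢ {x} {w} t = toWitnessFalse (proj₂ (T-∧-elim (A x w) t))

  count-N∖τ : ∀ x → count (N∖τ x) ≡ b
  count-N∖τ x = ℕ.suc-injective (begin
    suc (count (N∖τ x)) ≡⟨ count-remove (A x) (τ-~ x) ⟨
    count (A x)         ≡⟨ trans (regular x) (trans k≡b+1 (ℕ.+-comm b 1)) ⟩
    suc b               ∎)
    where open ≡-Reasoning

  N∖τ-outside : y ≢ τ x → N∖τ x y ≡ A x y
  N∖τ-outside {y} {x} y≢τx with y ≟ τ x
  ... | yes y≡τx = ⊥-elim (y≢τx y≡τx)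
  ... | no  _    = ∧-identityʳ (A x y)

  N∖τ⊆N∖τ-τ : T (N∖τ x w) → T (N∖τ (τ x) w)
  N∖τ⊆N∖τ-τ {x} t = N∖τ-intro (~-cn≡b⇒N⊆ (τ-~ x) (τ-cn x) (N∖τ⇒≢ t) (N∖τ⇒~ t))
                              (λ w≡ττx → ~⇒≢ (N∖τ⇒~ t) (sym (trans w≡ττx (τ-involutive x))))

  N∖τ-τ : ∀ x w → N∖τ x w ≡ N∖τ (τ x) w
  N∖τ-τ x w = T-injective N∖τ⊆N∖τ-τ (subst (λ z → T (N∖τ z w)) (τ-involutive x) ∘ N∖τ⊆N∖τ-τ)

  ≁-cn≡b⇒≁τ : ¬ x ~ y → cn x y ≡ b → ¬ y ~ τ x
  ≁-cn≡b⇒≁τ {x} {y} x≁y cn≡b y~τx =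
    x≁y (~-cn≡b⇒N⊆ (~-sym (τ-~ x)) (trans (cn-sym (τ x) x) (τ-cn x)) (cn≡b⇒≢ cn≡b ∘ sym) (~-sym y~τx))

  ≁-cn≡b⇒N∖τ⊆ : ¬ x ~ y → cn x y ≡ b → T (N∖τ x w) → T (N∖τ y w)
  ≁-cn≡b⇒N∖τ⊆ {x} {y} {w} x≁y cn≡b t = N∖τ-intro y~w w≢τy
    where
    common⊆N∖τ : ∀ w → T (A x w ∧ A y w) → T (N∖τ x w)
    common⊆N∖τ w t′ = let x~w , y~w = T-∧-elim (A x w) t′ in
      N∖τ-intro x~w (λ w≡τx → ≁-cn≡b⇒≁τ x≁y cn≡b (subst (y ~_) w≡τx y~w))
    y~w : y ~ w
    y~w = proj₂ (T-∧-elim (A x w)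
            (count-≤⇒⊇ common⊆N∖τ (ℕ.≤-reflexive (trans (count-N∖τ x) (sym cn≡b))) w t))
    w≢τy : w ≢ τ y
    w≢τy w≡τy = ≁-cn≡b⇒≁τ (x≁y ∘ ~-sym) (trans (cn-sym y x) cn≡b) (subst (x ~_) w≡τy (N∖τ⇒~ t))

  opaque
    E : Fin n → Fin n → Bool
    E x y = ⌊ x ≟ y ⌋ ∨ inB Γ b x y

    E-cases : T (E x y) → x ≡ y ⊎ cn x y ≡ b
    E-cases {x} {y} t with Equivalence.to (T-∨ {⌊ x ≟ y ⌋}) t
    ... | inj₁ x≡y  = inj₁ (toWitness x≡y)
    ... | inj₂ cn≡b = inj₂ (trans (cn-sym x y) (toWitness cn≡b))

    E-refl : ∀ x → T (E x x)
    E-refl x = Equivalence.from (T-∨ {⌊ x ≟ x ⌋}) (inj₁ (fromWitness refl))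

    cn≡b⇒E : cn x y ≡ b → T (E x y)
    cn≡b⇒E {x} {y} cn≡b = Equivalence.from (T-∨ {⌊ x ≟ y ⌋}) (inj₂ (fromWitness (trans (cn-sym y x) cn≡b)))

  E⇒N∖τ≗ : T (E x y) → ∀ w → N∖τ x w ≡ N∖τ y w
  E⇒N∖τ≗ {x} {y} t w with E-cases t
  ... | inj₁ refl = refl
  ... | inj₂ cn≡b with T? (A x y)
  ...   | yes x~y = trans (N∖τ-τ x w) (cong (λ z → N∖τ z w) (sym (τ-unique x~y cn≡b)))
  ...   | no  x≁y =
    T-injective (≁-cn≡b⇒N∖τ⊆ x≁y cn≡b) (≁-cn≡b⇒N∖τ⊆ (x≁y ∘ ~-sym) (trans (cn-sym y x) cn≡b))

  N∖τ≗⇒E : (∀ w → N∖τ x w ≡ N∖τ y w) → T (E x y)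
  N∖τ≗⇒E {x} {y} same with x ≟ y
  ... | yes refl = E-refl x
  ... | no  x≢y  with dichotomy x y x≢y
  ...   | inj₁ cn≡b = cn≡b⇒E cn≡b
  ...   | inj₂ cn≡a = ⊥-elim (ℕ.<⇒≱ a<b (subst (b ≤_) cn≡a b≤cn))
    where
    b≤cn : b ≤ cn x y
    b≤cn = subst (_≤ cn x y) (count-N∖τ x)
      (count-mono (λ w t → T-∧-intro (N∖τ⇒~ t) (N∖τ⇒~ (subst T (same w) t))))

  E-isEquivalence : IsEquivalence (λ x y → T (E x y))
  E-isEquivalence = record
    { refl  = E-refl _
    ; sym   = λ t → N∖τ≗⇒E (sym ∘ E⇒N∖τ≗ t)
    ; trans = λ s t → N∖τ≗⇒E (λ w → trans (E⇒N∖τ≗ s w) (E⇒N∖τ≗ t w))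
    }

  open IsEquivalence E-isEquivalence using () renaming (sym to E-sym; trans to E-trans)

  τ-E : ∀ x → T (E x (τ x))
  τ-E x = cn≡b⇒E (τ-cn x)

  E∧~⇒τ : T (E x y) → x ~ y → y ≡ τ x
  E∧~⇒τ t x~y with E-cases t
  ... | inj₁ refl = ⊥-elim (~-irrefl x~y)
  ... | inj₂ cn≡b = τ-unique x~y cn≡b

  ¬E⇒≢ : ¬ T (E x y) → x ≢ y
  ¬E⇒≢ {x} ¬E refl = ¬E (E-refl x)

  ¬E⇒cn≡a : ¬ T (E x y) → cn x y ≡ a
  ¬E⇒cn≡a {x} {y} ¬E = [ (λ cn≡b → ⊥-elim (¬E (cn≡b⇒E cn≡b))) , id ]′ (dichotomy x y (¬E⇒≢ ¬E))

  ¬E⇒≢τ : ¬ T (E x y) → y ≢ τ x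
  ¬E⇒≢τ ¬E refl = ¬E (τ-E _)

  adj-class-invariant : T (E x u) → ¬ T (E x y) → A x y ≡ A u y
  adj-class-invariant {x} {u} {y} x∼u ¬E = begin
    A x y     ≡⟨ N∖τ-outside (¬E⇒≢τ ¬E) ⟨
    N∖τ x y   ≡⟨ E⇒N∖τ≗ x∼u y ⟩
    N∖τ u y   ≡⟨ N∖τ-outside (¬E⇒≢τ (¬E ∘ E-trans x∼u)) ⟩
    A u y     ∎
    where open ≡-Reasoning

  classSize : Fin n → ℕ
  classSize x = count (E x)

  cn-by-class : ∀ x y → cn x y ≡ (if ⌊ x ≟ y ⌋ then 1 else 0) + (if E x y then b else a)
  cn-by-class x y with x ≟ y | E x y in exy
  ... | yes refl | true  = cn-diag x
  ... | yes refl | false = ⊥-elim (subst T exy (E-refl x))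
  ... | no  x≢y  | true  = [ (λ x≡y → ⊥-elim (x≢y x≡y)) , id ]′ (E-cases (subst T (sym exy) tt))
  ... | no  _    | false = ¬E⇒cn≡a (subst T exy)

  ∑-cn : ∀ x → ∑[ y < n ] cn x y ≡ 1 + (b * classSize x + a * count (not ∘ E x))
  ∑-cn x = begin
    ∑[ y < n ] cn x y
      ≡⟨ sum-cong-≗ (cn-by-class x) ⟩
    ∑[ y < n ] ((if ⌊ x ≟ y ⌋ then 1 else 0) + (if E x y then b else a))
      ≡⟨ ∑-distrib-+ (λ y → if ⌊ x ≟ y ⌋ then 1 else 0) (λ y → if E x y then b else a) ⟩
    ∑[ y < n ] (if ⌊ x ≟ y ⌋ then 1 else 0) + ∑[ y < n ] (if E x y then b else a)
      ≡⟨ cong₂ _+_ (trans (sym (count-as-sum (λ y → ⌊ x ≟ y ⌋))) (count-≟ x)) (∑-if (E x) b a) ⟩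
    1 + (b * classSize x + a * count (not ∘ E x))
      ∎
    where open ≡-Reasoning

  classSize+rest : ∀ x → classSize x + count (not ∘ E x) ≡ n
  classSize+rest x = trans (sym (count-split (λ _ → true) (E x))) count-true

  classSize-const : ∀ x y → classSize x ≡ classSize y
  classSize-const x y = split-by-weights a<b
    (ℕ.suc-injective (trans (weighted x) (sym (weighted y))))
    (trans (classSize+rest x) (sym (classSize+rest y)))
    where
    weighted : ∀ x → 1 + (b * classSize x + a * count (not ∘ E x)) ≡ k * k
    weighted x = trans (sym (∑-cn x)) (∑-commonNbrs Γ regular x)

  opaque
    unfolding E

    classSize≡1+β : ∀ x → classSize x ≡ suc (sizeB Γ b x)
    classSize≡1+β x = trans (count-∨ disjoint) (cong (_+ sizeB Γ b x) (count-≟ x))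
      where
      disjoint : ∀ y → T ⌊ x ≟ y ⌋ → ¬ T (inB Γ b x y)
      disjoint y x≡y t = cn≡b⇒≢ (toWitness t) (sym (toWitness x≡y))

  x₀ : Fin n
  x₀ = Fin.fromℕ< (proj₁ deza)

  s : ℕ
  s = classSize x₀

  3≤s : 3 ≤ s
  3≤s = subst (3 ≤_) (sym (classSize≡1+β x₀)) (s≤s (β>1 x₀))

  N∖τ⇒¬E : T (N∖τ x w) → ¬ T (E x w)
  N∖τ⇒¬E {x} {w} t x∼w = ~-irrefl (N∖τ⇒~ (subst T (E⇒N∖τ≗ x∼w w) t))

  N∖τ-E-closed : T (E w u) → T (N∖τ x w) → T (N∖τ x u)
  N∖τ-E-closed {w} {u} {x} w∼u t = N∖τ-intro (~-sym u~x) u≢τx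
    where
    ¬w∼x : ¬ T (E w x)
    ¬w∼x = N∖τ⇒¬E t ∘ E-sym
    u~x : u ~ x
    u~x = subst T (adj-class-invariant w∼u ¬w∼x) (~-sym (N∖τ⇒~ t))
    u≢τx : u ≢ τ x
    u≢τx refl = ¬w∼x (E-sym (E-trans (τ-E x) (E-sym w∼u)))

  common : Fin n → Fin n → Fin n → Bool
  common x y w = N∖τ x w ∧ N∖τ y w

  s∣common : ∀ x y → s ∣ count (common x y)
  s∣common x y = Partition-∣ (partition (common x y) E E-isEquivalence s class-size)
    where
    closed : ∀ {z} → T (common x y z) → ∀ w → T (E z w) → T (common x y w)
    closed t w z∼w = let tx , ty = T-∧-elim (N∖τ x _) t in
      T-∧-intro (N∖τ-E-closed z∼w tx) (N∖τ-E-closed z∼w ty)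
    class-size : ∀ z → T (common x y z) → count (λ w → common x y w ∧ E z w) ≡ s
    class-size z t = trans
      (count-cong λ w → T-injective (proj₂ ∘ T-∧-elim (common x y w)) λ z∼w → T-∧-intro (closed t w z∼w) z∼w)
      (classSize-const z x₀)

  A-τ : ¬ T (E x y) → A (τ x) y ≡ A x y
  A-τ {x} ¬E = sym (adj-class-invariant (τ-E x) ¬E)

  cn-¬E-≁ : ¬ T (E x y) → ¬ x ~ y → cn x y ≡ count (common x y)
  cn-¬E-≁ {x} {y} ¬E x≁y = count-cong λ w → T-injective (to w) (from w)
    where
    to : ∀ w → T (A x w ∧ A y w) → T (common x y w)
    to w t = let x~w , y~w = T-∧-elim (A x w) t in
      T-∧-intro (N∖τ-intro x~w λ { refl → x≁y (subst T (A-τ ¬E) (~-sym y~w)) })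
                (N∖τ-intro y~w λ { refl → x≁y (~-sym (subst T (A-τ (¬E ∘ E-sym)) (~-sym x~w))) })
    from : ∀ w → T (common x y w) → T (A x w ∧ A y w)
    from w t = let tx , ty = T-∧-elim (N∖τ x w) t in T-∧-intro (N∖τ⇒~ tx) (N∖τ⇒~ ty)

  cn-¬E-~ : ¬ T (E x y) → x ~ y → cn x y ≡ 2 + count (common x y)
  cn-¬E-~ {x} {y} ¬E x~y = begin
    count (λ w → A x w ∧ A y w)
      ≡⟨ count-remove (λ w → A x w ∧ A y w) (T-∧-intro (τ-~ x) y~τx) ⟩
    suc (count (λ w → (A x w ∧ A y w) ∧ not ⌊ w ≟ τ x ⌋))
      ≡⟨ cong suc (count-remove (λ w → (A x w ∧ A y w) ∧ not ⌊ w ≟ τ x ⌋)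
                     (T-∧-intro (T-∧-intro x~τy (τ-~ y)) (fromWitnessFalse τy≢τx))) ⟩
    2 + count (λ w → ((A x w ∧ A y w) ∧ not ⌊ w ≟ τ x ⌋) ∧ not ⌊ w ≟ τ y ⌋)
      ≡⟨ cong (2 +_) (count-cong λ w → trans (∧-assoc (A x w ∧ A y w) _ _) (interchange (A x w) (A y w) _ _)) ⟩
    2 + count (common x y)
      ∎
    where
    open ≡-Reasoning
    y~τx : y ~ τ x
    y~τx = ~-sym (subst T (sym (A-τ ¬E)) x~y)
    x~τy : x ~ τ y
    x~τy = ~-sym (subst T (sym (A-τ (¬E ∘ E-sym))) (~-sym x~y))
    τy≢τx : τ y ≢ τ x
    τy≢τx eq = ¬E⇒≢ ¬E (trans (sym (τ-involutive x)) (trans (cong τ (sym eq)) (τ-involutive y)))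

  N∖τ-nonempty : ∀ x → ∃ λ w → T (N∖τ x w)
  N∖τ-nonempty x = count-pos (N∖τ x) (subst (0 <_) (sym (count-N∖τ x)) (ℕ.≤-<-trans z≤n a<b))

  -- If x, y were in different classes, a = |N(x) ∩ N(y)| would be a multiple of s, while for
  -- a neighbour z of x outside its class a = |N(x) ∩ N(z)| is 2 more than a multiple of s.
  ≁⇒E : ¬ x ~ y → T (E x y)
  ≁⇒E {x} {y} x≁y with T? (E x y) | N∖τ-nonempty x
  ... | yes x∼y | _      = x∼y
  ... | no  ¬E  | z , z∈ = ⊥-elim (ℕ.<⇒≱ 3≤s (∣⇒≤ s∣2))
    where
    gap : count (common x y) ≡ count (common x z) + 2
    gap = begin
      count (common x y)     ≡⟨ cn-¬E-≁ ¬E x≁y ⟨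
      cn x y                 ≡⟨ ¬E⇒cn≡a ¬E ⟩
      a                      ≡⟨ ¬E⇒cn≡a (N∖τ⇒¬E z∈) ⟨
      cn x z                 ≡⟨ cn-¬E-~ (N∖τ⇒¬E z∈) (N∖τ⇒~ z∈) ⟩
      2 + count (common x z) ≡⟨ ℕ.+-comm 2 _ ⟩
      count (common x z) + 2 ∎
      where open ≡-Reasoning
    s∣2 : s ∣ 2
    s∣2 = ∣m+n∣m⇒∣n (subst (s ∣_) gap (s∣common x y)) (s∣common x z)

  ¬E⇒~ : ¬ T (E x y) → x ~ y
  ¬E⇒~ {x} {y} ¬E with T? (A x y)
  ... | yes x~y = x~y
  ... | no  x≁y = ⊥-elim (¬E (≁⇒E x≁y))

  adj-by-class : ∀ x y → A x y ≡ not (E x y) ∨ ⌊ τ x ≟ y ⌋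
  adj-by-class x y = T-injective to from
    where
    to : x ~ y → T (not (E x y) ∨ ⌊ τ x ≟ y ⌋)
    to x~y with T? (E x y)
    ... | yes x∼y = Equivalence.from (T-∨ {not (E x y)}) (inj₂ (fromWitness (sym (E∧~⇒τ x∼y x~y))))
    ... | no  ¬E  = Equivalence.from (T-∨ {not (E x y)}) (inj₁ (T-not ¬E))
    from : T (not (E x y) ∨ ⌊ τ x ≟ y ⌋) → x ~ y
    from t = [ ¬E⇒~ ∘ T-not⁻¹ , (λ τx≡y → subst (x ~_) (toWitness τx≡y) (τ-~ x)) ]′
               (Equivalence.to (T-∨ {not (E x y)}) t)

  n∸k+1≡s : n ∸ k + 1 ≡ s
  n∸k+1≡s = begin
    n ∸ k + 1               ≡⟨ cong₂ (λ n k → n ∸ k + 1) n≡ k≡ ⟩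
    (suc β + c) ∸ suc c + 1 ≡⟨ cong (_+ 1) (ℕ.m+n∸n≡m β c) ⟩
    β + 1                   ≡⟨ ℕ.+-comm β 1 ⟩
    suc β                   ≡⟨ classSize≡1+β x₀ ⟨
    s                       ∎
    where
    open ≡-Reasoning
    β = sizeB Γ b x₀
    c = count (not ∘ E x₀)
    n≡ : n ≡ suc β + c
    n≡ = trans (sym (classSize+rest x₀)) (cong (_+ c) (classSize≡1+β x₀))
    disjoint : ∀ y → T (not (E x₀ y)) → ¬ T ⌊ τ x₀ ≟ y ⌋
    disjoint y ¬E τx₀≡y = T-not⁻¹ ¬E (subst (T ∘ E x₀) (toWitness τx₀≡y) (τ-E x₀))
    k≡ : k ≡ suc c
    k≡ = begin
      k                                                   ≡⟨ regular x₀ ⟨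
      count (A x₀)                                        ≡⟨ count-cong (adj-by-class x₀) ⟩
      count (λ y → not (E x₀ y) ∨ ⌊ τ x₀ ≟ y ⌋)           ≡⟨ count-∨ disjoint ⟩
      c + count (λ y → ⌊ τ x₀ ≟ y ⌋)                      ≡⟨ cong (c +_) (count-≟ (τ x₀)) ⟩
      c + 1                                               ≡⟨ ℕ.+-comm c 1 ⟩
      suc c                                               ∎

  open Orbits τ τ-involutive τ-fixfree

  lower-τ : ∀ y → lower (τ y) ≡ not (lower y)
  lower-τ y = T-injective (λ t → T-not λ by → lower⇒¬lower-σ y by t) (¬lower⇒lower-σ y ∘ T-not⁻¹)

  E-τ : ∀ x y → E x (τ y) ≡ E x y
  E-τ x y = T-injective (λ t → E-trans t (E-sym (τ-E y))) (λ t → E-trans t (τ-E y))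

  half : Fin n → ℕ
  half x = count (λ y → lower y ∧ E x y)

  classSize≡2*half : ∀ x → classSize x ≡ 2 * half x
  classSize≡2*half x = begin
    count (E x)                                                  ≡⟨ count-split (E x) lower ⟩
    count (λ y → E x y ∧ lower y) + count (λ y → E x y ∧ not (lower y))
      ≡⟨ cong₂ _+_ (count-cong λ y → ∧-comm (E x y) (lower y)) (count-cong upper≡lower∘τ) ⟩
    half x + count (λ y → lower (τ y) ∧ E x (τ y))
      ≡⟨ cong (half x +_) (count-permute (permutation τ τ τ-involutive τ-involutive) (λ y → lower y ∧ E x y)) ⟩
    half x + half x                                              ≡⟨ cong (half x +_) (ℕ.+-identityʳ (half x)) ⟨
    2 * half x                                                   ∎
    where
    open ≡-Reasoning
    upper≡lower∘τ : ∀ y → E x y ∧ not (lower y) ≡ lower (τ y) ∧ E x (τ y)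
    upper≡lower∘τ y rewrite lower-τ y | E-τ x y = ∧-comm (E x y) (not (lower y))

  m : ℕ
  m = half x₀

  2*m≡n∸k+1 : 2 * m ≡ n ∸ k + 1
  2*m≡n∸k+1 = trans (sym (classSize≡2*half x₀)) (sym n∸k+1≡s)

  half-const : ∀ x → half x ≡ m
  half-const x = ℕ.*-cancelˡ-≡ (half x) m 2
    (trans (sym (classSize≡2*half x)) (trans (classSize-const x x₀) (classSize≡2*half x₀)))

  open Partition (partition lower E E-isEquivalence m (λ x _ → half-const x)) public

  E-orbit : ∀ u → T (E u (proj₁ (proj₁ (orbit u))))
  E-orbit u with orbit-rep u
  ... | inj₁ eq = subst (T ∘ E u) (sym eq) (E-refl u)
  ... | inj₂ eq = subst (T ∘ E u) (sym eq) (τ-E u)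

  side : Fin n → Fin 2
  side u = proj₂ (orbit u)

  opaque
    code : Fin n → Fin parts × Fin m
    code u = Inverse.to index (proj₁ (orbit u))

    Φ : Fin n ↔ ((Fin parts × Fin m) × Fin 2)
    Φ = ↔-trans orbits (index ×-↔ ↔-refl)

    Φ-to : ∀ u → Inverse.to Φ u ≡ (code u , side u)
    Φ-to u = refl


    code⇔ : ∀ u v → code u ≡ code v ⇔ proj₁ (orbit u) ≡ proj₁ (orbit v)
    code⇔ u v = mk⇔ (↔-injective index) (cong (Inverse.to index))

    code-part⇔ : ∀ u v → proj₁ (code u) ≡ proj₁ (code v) ⇔ T (E u v)
    code-part⇔ u v = mk⇔
      (λ eq → E-trans (E-orbit u) (E-trans (Equivalence.to same-part eq) (E-sym (E-orbit v))))
      (λ u∼v → Equivalence.from same-part (E-trans (E-sym (E-orbit u)) (E-trans u∼v (E-orbit v))))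
      where
      same-part : proj₁ (code u) ≡ proj₁ (code v) ⇔ T (E (proj₁ (proj₁ (orbit u))) (proj₁ (proj₁ (orbit v))))
      same-part = same-part⇔ (proj₁ (orbit u)) (proj₁ (orbit v))

  adj-code : ∀ u v → twoCliqueExtension ≟-pair (completeMultipartite parts m) (code u , side u) (code v , side v) ≡ A u v
  adj-code u v = trans (cong₂ (λ p q → not p ∨ q) same-part≡E twins≡τ) (sym (adj-by-class u v))
    where
    same-part≡E : ⌊ proj₁ (code u) ≟ proj₁ (code v) ⌋ ≡ E u v
    same-part≡E = T-injective (Equivalence.to (code-part⇔ u v) ∘ toWitness)
                              (fromWitness ∘ Equivalence.from (code-part⇔ u v))
    twins≡τ : (⌊ ≟-pair (code u) (code v) ⌋ ∧ not ⌊ side u ≟ side v ⌋) ≡ ⌊ τ u ≟ v ⌋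
    twins≡τ = T-injective
      (λ t → let same , differ = T-∧-elim ⌊ ≟-pair (code u) (code v) ⌋ t in
             fromWitness (sym (Equivalence.to (twins⇔ u v)
               (Equivalence.to (code⇔ u v) (toWitness {a? = ≟-pair (code u) (code v)} same) , toWitnessFalse differ))))
      (λ t → let same , differ = Equivalence.from (twins⇔ u v) (sym (toWitness t)) in
             T-∧-intro {⌊ ≟-pair (code u) (code v) ⌋}
               (fromWitness (Equivalence.from (code⇔ u v) same)) (fromWitnessFalse differ))

  Φ-adj : ∀ u v → twoCliqueExtension ≟-pair (completeMultipartite parts m) (Inverse.to Φ u) (Inverse.to Φ v) ≡ A u v
  Φ-adj u v = subst₂ (λ p q → twoCliqueExtension ≟-pair (completeMultipartite parts m) p q ≡ A u v)
                     (sym (Φ-to u)) (sym (Φ-to v)) (adj-code u v)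

lemma20 : (n k b a : ℕ) (Γ : Graph (Fin n)) →
    IsStrictlyDeza Γ k b a →
    k ≡ b + 1 →
    (∀ v → 1 < sizeB Γ b v) →
    (∀ v → TypeC Γ b v) →
    ∃[ t ] ∃[ m ] (2 * m ≡ n ∸ k + 1 ×
      Isomorphic Γ (twoCliqueExtension ≟-pair (completeMultipartite t m)))
lemma20 n k b a Γ (deza , _ , ¬srg) k≡b+1 β>1 typeC = parts , m , 2*m≡n∸k+1 , Φ , Φ-adj
  where open TypeCDeza Γ deza (Deza⇒a<b Γ deza ¬srg) k≡b+1 β>1 typeC
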